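{- Let $n_1,\dots,n_k\ge 2$ be pairwise coprime integers. Then the type graph $\Gamma^T(\mathbb{Z}_{n_1}\times\cdots\times\mathbb{Z}_{n_k})$ is isomorphic to the type graph $\Gamma^T(\mathbb{Z}_{n_1n_2\cdots n_k})$.
   Context: For integers $n_1,\dots,n_k\ge2$, the type graph $\Gamma^T(\mathbb{Z}_{n_1}\times\cdots\times\mathbb{Z}_{n_k})$ is the simple graph defined as follows. Its vertices are the type classes $T(x_1,\dots,x_k)$, where each $x_i$ is either $0$ or a positive divisor of $n_i$ with $x_i<n_i$ (so $x_i=1$ is allowed), and $(x_1,\dots,x_k)$ is neither $(0,\dots,0)$ nor $(1,\dots,1)$. Here $T(x_1,\dots,x_k)$ is the set of tuples $(a_1,\dots,a_k)$ with $a_i=0$ if $x_i=0$, and $a_i\neq0$ with $\gcd(a_i,n_i)=x_i$ if $x_i\neq 0$. Two distinct vertices $T(x)$ and $T(y)$ are adjacent iff $x_iy_i\equiv 0\pmod{n_i}$ for all $i$. In particular (case $k=1$), for $n\ge2$ the type graph $\Gamma^T(\mathbb{Z}_n)$ has vertices $T_a=\{x\in\mathbb{Z}_n\setminus\{0\}:\gcd(x,n)=a\}$ for the divisors $a$ of $n$ with $1<a<n$, with $T_a,T_b$ ($a\ne b$) adjacent iff $ab\equiv0\pmod n$. -}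

module Defs where

open import Data.Nat using (ℕ; _<_; _≤_; _*_)
open import Data.Nat.Divisibility using (_∣_)
open import Data.Nat.Coprimality using (Coprime)
open import Data.Fin using (Fin)
open import Data.Product using (Σ; _×_; proj₁)
open import Data.Sum using (_⊎_)
open import Data.Empty using (⊥)
open import Relation.Binary.PropositionalEquality using (_≡_; _≢_)
open import Relation.Nullary using (¬_)

Tuple : ℕ → Set
Tuple k = Fin k → ℕ

-- Pointwise equality of tuples (identity of type classes T(x) is given by the tuple x).
_≋_ : ∀ {k} → Tuple k → Tuple k → Set
x ≋ y = ∀ i → x i ≡ y i

ValidLabel : ℕ → ℕ → Set
ValidLabel m x = (x ≡ 0) ⊎ ((x ∣ m) × (0 < x) × (x < m))

-- x = (x₁,…,x_k) indexes a vertex T(x) of Γ^T(ℤ_{n₁} × ⋯ × ℤ_{n_k}):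
-- each xᵢ valid, x ≠ (0,…,0), x ≠ (1,…,1).
IsTypeVertex : ∀ {k} → Tuple k → Tuple k → Set
IsTypeVertex {k} n x =
  (∀ i → ValidLabel (n i) (x i)) × ¬ (∀ i → x i ≡ 0) × ¬ (∀ i → x i ≡ 1)

TVertex : ∀ {k} → Tuple k → Set
TVertex {k} n = Σ (Tuple k) (IsTypeVertex n)

TAdj : ∀ {k} (n : Tuple k) → TVertex n → TVertex n → Set
TAdj n u v = ¬ (proj₁ u ≋ proj₁ v) × (∀ i → n i ∣ proj₁ u i * proj₁ v i)

-- The single modulus m viewed as a 1-tuple: Γ^T(ℤ_m) is the k = 1 case.
single : ℕ → Tuple 1
single m _ = m

record TypeGraphIso {k k′ : ℕ} (n : Tuple k) (n′ : Tuple k′) : Set where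
  field
    to        : TVertex n → TVertex n′
    from      : TVertex n′ → TVertex n
    from-to   : ∀ v → proj₁ (from (to v)) ≋ proj₁ v
    to-from   : ∀ w → proj₁ (to (from w)) ≋ proj₁ w
    to-resp   : ∀ u v → proj₁ u ≋ proj₁ v → proj₁ (to u) ≋ proj₁ (to v)
    from-resp : ∀ u v → proj₁ u ≋ proj₁ v → proj₁ (from u) ≋ proj₁ (from v)
    adj-to    : ∀ u v → TAdj n u v → TAdj n′ (to u) (to v)
    adj-from  : ∀ u v → TAdj n′ (to u) (to v) → TAdj n u v

prodT : ∀ {k} → Tuple k → ℕ
prodT {ℕ.zero} n = 1
prodT {ℕ.suc k} n = n Fin.zero * prodT {k} (λ i → n (Fin.suc i))

-- Sending a type label x to the common value dᵢ = gcd(aᵢ, nᵢ) of the elements aᵢ of its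
-- class identifies the vertices of Γ^T(ℤ_{n₁} × ⋯ × ℤ_{n_k}) with the divisor tuples
-- (d₁,…,d_k), dᵢ ∣ nᵢ, other than (n₁,…,n_k) and (1,…,1); similarly the vertices of
-- Γ^T(ℤ_N), N = n₁ ⋯ n_k, are the divisors of N other than N and 1. For pairwise coprime
-- moduli the divisors of N are exactly the products d₁ ⋯ d_k (with dᵢ = gcd(d, nᵢ)), and
-- N ∣ (d₁ ⋯ d_k)(e₁ ⋯ e_k) holds iff nᵢ ∣ dᵢ eᵢ for every i, which is adjacency on both sides.
module Submission where

open import Defs
open import Algebra.Properties.CommutativeSemigroup using (x∙yz≈y∙xz)
open import Data.Nat using (ℕ; zero; suc; z<s; _*_; _<_; _≤_; NonZero; ≢-nonZero⁻¹; >-nonZero)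
open import Data.Nat.Properties
  using (_≟_; *-comm; *-identityˡ; *-zeroʳ; *-commutativeSemigroup; m*n≢0; <⇒≤; <⇒≢; ≤∧≢⇒<; n≢0⇒n>0)
open import Data.Nat.Divisibility
open import Data.Nat.Coprimality using (Coprime; coprime-divisor) renaming (sym to coprime-sym)
open import Data.Nat.GCD using (gcd; gcd[m,n]∣m; gcd[m,n]∣n; gcd-greatest; gcd-comm; gcd-zeroʳ; gcd[m,n]≢0; c*gcd[m,n]≡gcd[cm,cn])
open import Data.Fin using (Fin; punchIn)
open import Data.Fin.Properties using (punchInᵢ≢i; suc-injective)
open import Data.Product using (_×_; _,_; proj₁)
open import Data.Sum using (inj₁; inj₂)
open import Data.Empty using (⊥-elim)
open import Function using (_∘_)
open import Relation.Nullary using (¬_; yes; no)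
open import Relation.Binary.PropositionalEquality
  using (_≡_; _≢_; refl; sym; trans; cong; cong₂; subst; module ≡-Reasoning)

open ≡-Reasoning

PairwiseCoprime : ∀ {k} → Tuple k → Set
PairwiseCoprime a = ∀ i j → i ≢ j → Coprime (a i) (a j)

coprime-∣ : ∀ {m n c d} → Coprime m n → c ∣ m → d ∣ n → Coprime c d
coprime-∣ m⊥n c∣m d∣n (e∣c , e∣d) = m⊥n (∣-trans e∣c c∣m , ∣-trans e∣d d∣n)

coprime-* : ∀ {m n o} → Coprime m n → Coprime m o → Coprime m (n * o)
coprime-* m⊥n m⊥o (d∣m , d∣no) = m⊥o (d∣m , coprime-divisor (coprime-∣ m⊥n d∣m ∣-refl) d∣no)

coprime-∣⇒*-∣ : ∀ {m n o} → Coprime m n → m ∣ o → n ∣ o → m * n ∣ o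
coprime-∣⇒*-∣ {m} {n} m⊥n (divides q refl) n∣qm =
  subst (m * n ∣_) (*-comm m q) (*-monoʳ-∣ m (coprime-divisor (coprime-sym m⊥n) (subst (n ∣_) (*-comm q m) n∣qm)))

∣-*-gcdˡ : ∀ {g x} a b → g ∣ x → g ∣ a * b → g ∣ gcd x a * b
∣-*-gcdˡ {g} {x} a b g∣x g∣ab = subst (g ∣_) gcd[xb,ab]≡gcd[x,a]b (gcd-greatest (∣m⇒∣m*n b g∣x) g∣ab)
  where
  gcd[xb,ab]≡gcd[x,a]b : gcd (x * b) (a * b) ≡ gcd x a * b
  gcd[xb,ab]≡gcd[x,a]b = begin
    gcd (x * b) (a * b) ≡⟨ cong₂ gcd (*-comm x b) (*-comm a b) ⟩
    gcd (b * x) (b * a) ≡⟨ c*gcd[m,n]≡gcd[cm,cn] b x a ⟨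
    b * gcd x a         ≡⟨ *-comm b (gcd x a) ⟩
    gcd x a * b         ∎

∣-*-gcdʳ : ∀ {g x} a b → g ∣ x → g ∣ a * b → g ∣ a * gcd x b
∣-*-gcdʳ {g} {x} a b g∣x g∣ab =
  subst (g ∣_) (sym (c*gcd[m,n]≡gcd[cm,cn] a x b)) (gcd-greatest (∣n⇒∣m*n a g∣x) g∣ab)

∣-*-gcd : ∀ {g x} a b → g ∣ x → g ∣ a * b → g ∣ gcd x a * gcd x b
∣-*-gcd {x = x} a b g∣x g∣ab = ∣-*-gcdʳ (gcd x a) b g∣x (∣-*-gcdˡ a b g∣x g∣ab)

gcd[m,a*r]≡a : ∀ {m a r} → a ∣ m → Coprime m r → gcd m (a * r) ≡ a
gcd[m,a*r]≡a {m} {a} {r} a∣m m⊥r = ∣-antisym g∣a (gcd-greatest a∣m (m∣m*n r))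
  where
  g∣a : gcd m (a * r) ∣ a
  g∣a = coprime-divisor (coprime-∣ m⊥r (gcd[m,n]∣m m (a * r)) ∣-refl)
                        (subst (gcd m (a * r) ∣_) (*-comm a r) (gcd[m,n]∣n m (a * r)))

gcd[d,m]≡d : ∀ {d m} → d ∣ m → gcd d m ≡ d
gcd[d,m]≡d d∣m = ∣-antisym (gcd[m,n]∣m _ _) (gcd-greatest ∣-refl d∣m)

prodT-cong : ∀ {k} {a b : Tuple k} → a ≋ b → prodT a ≡ prodT b
prodT-cong {zero}  a≋b = refl
prodT-cong {suc k} a≋b = cong₂ _*_ (a≋b Fin.zero) (prodT-cong (a≋b ∘ Fin.suc))

prodT-1 : ∀ k → prodT {k} (λ _ → 1) ≡ 1
prodT-1 zero    = refl
prodT-1 (suc k) = trans (*-identityˡ _) (prodT-1 k)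

prodT-nonZero : ∀ {k} (a : Tuple k) → (∀ i → NonZero (a i)) → NonZero (prodT a)
prodT-nonZero {zero}  a nz = _
prodT-nonZero {suc k} a nz =
  m*n≢0 (a Fin.zero) _ {{nz Fin.zero}} {{prodT-nonZero (a ∘ Fin.suc) (nz ∘ Fin.suc)}}

prodT-punchIn : ∀ {k} (a : Tuple (suc k)) i → prodT a ≡ a i * prodT (a ∘ punchIn i)
prodT-punchIn a Fin.zero = refl
prodT-punchIn {suc k} a (Fin.suc i) = begin
  a Fin.zero * prodT (a ∘ Fin.suc)
    ≡⟨ cong (a Fin.zero *_) (prodT-punchIn (a ∘ Fin.suc) i) ⟩
  a Fin.zero * (a (Fin.suc i) * prodT (a ∘ Fin.suc ∘ punchIn i))
    ≡⟨ x∙yz≈y∙xz *-commutativeSemigroup (a Fin.zero) (a (Fin.suc i)) _ ⟩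
  a (Fin.suc i) * (a Fin.zero * prodT (a ∘ Fin.suc ∘ punchIn i)) ∎

∣-prodT : ∀ {k} (a : Tuple k) i → a i ∣ prodT a
∣-prodT {suc k} a i = subst (a i ∣_) (sym (prodT-punchIn a i)) (m∣m*n _)

prodT-mono-∣ : ∀ {k} {a b : Tuple k} → (∀ i → a i ∣ b i) → prodT a ∣ prodT b
prodT-mono-∣ {zero}  a∣b = ∣-refl
prodT-mono-∣ {suc k} a∣b = *-pres-∣ (a∣b Fin.zero) (prodT-mono-∣ (a∣b ∘ Fin.suc))

coprime-prodT : ∀ {k m} (a : Tuple k) → (∀ i → Coprime m (a i)) → Coprime m (prodT a)
coprime-prodT {zero}  a m⊥a (_ , d∣1) = ∣1⇒≡1 d∣1
coprime-prodT {suc k} a m⊥a = coprime-* (m⊥a Fin.zero) (coprime-prodT (a ∘ Fin.suc) (m⊥a ∘ Fin.suc))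

prodT-∣ : ∀ {k m} (a : Tuple k) → PairwiseCoprime a → (∀ i → a i ∣ m) → prodT a ∣ m
prodT-∣ {zero}  a a⊥a a∣m = 1∣ _
prodT-∣ {suc k} a a⊥a a∣m =
  coprime-∣⇒*-∣ (coprime-prodT (a ∘ Fin.suc) (λ i → a⊥a Fin.zero (Fin.suc i) λ ()))
    (a∣m Fin.zero)
    (prodT-∣ (a ∘ Fin.suc) (λ i j i≢j → a⊥a (Fin.suc i) (Fin.suc j) (i≢j ∘ suc-injective)) (a∣m ∘ Fin.suc))

gcd-prodT-factor : ∀ {k m} (e : Tuple k) i → e i ∣ m → (∀ j → j ≢ i → Coprime m (e j)) →
                   gcd m (prodT e) ≡ e i
gcd-prodT-factor {suc k} {m} e i eᵢ∣m m⊥eⱼ = begin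
  gcd m (prodT e)                      ≡⟨ cong (gcd m) (prodT-punchIn e i) ⟩
  gcd m (e i * prodT (e ∘ punchIn i))  ≡⟨ gcd[m,a*r]≡a eᵢ∣m (coprime-prodT _ (λ j → m⊥eⱼ _ (punchInᵢ≢i i j))) ⟩
  e i                                  ∎

gcd-prodT-∣ : ∀ {k} d (a : Tuple k) → gcd d (prodT a) ∣ prodT (λ i → gcd d (a i))
gcd-prodT-∣ {zero}  d a = subst (_∣ 1) (sym (gcd-zeroʳ d)) ∣-refl
gcd-prodT-∣ {suc k} d a =
  ∣-trans (∣-*-gcd (a Fin.zero) _ (gcd[m,n]∣m d _) (gcd[m,n]∣n d _))
          (*-monoʳ-∣ (gcd d (a Fin.zero)) (gcd-prodT-∣ d (a ∘ Fin.suc)))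

module CoprimeModuli {k} (n : Tuple k) (n⊥n : PairwiseCoprime n) where

  gcd-prodT : ∀ d → gcd d (prodT n) ≡ prodT (λ i → gcd d (n i))
  gcd-prodT d = ∣-antisym (gcd-prodT-∣ d n)
    (gcd-greatest (prodT-∣ gcd[d,n] (λ i j i≢j → coprime-∣ (n⊥n i j i≢j) (gcd[m,n]∣n d _) (gcd[m,n]∣n d _))
                             (λ i → gcd[m,n]∣m d _))
                  (prodT-mono-∣ {a = gcd[d,n]} (λ i → gcd[m,n]∣n d (n i))))
    where
    gcd[d,n] : Tuple k
    gcd[d,n] i = gcd d (n i)

  gcd-prodT-divisors : ∀ {e} → (∀ i → e i ∣ n i) → ∀ i → gcd (n i) (prodT e) ≡ e i
  gcd-prodT-divisors {e} e∣n i =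
    gcd-prodT-factor e i (e∣n i) (λ j j≢i → coprime-∣ (n⊥n i j (j≢i ∘ sym)) ∣-refl (e∣n j))

  ∣-pointwise⇒prodT-∣ : ∀ {e f} → (∀ i → n i ∣ e i * f i) → prodT n ∣ prodT e * prodT f
  ∣-pointwise⇒prodT-∣ {e} {f} n∣ef = prodT-∣ n n⊥n (λ i → ∣-trans (n∣ef i) (*-pres-∣ (∣-prodT e i) (∣-prodT f i)))

  prodT-∣⇒∣-pointwise : ∀ {e f} → (∀ i → e i ∣ n i) → (∀ i → f i ∣ n i) →
                        prodT n ∣ prodT e * prodT f → ∀ i → n i ∣ e i * f i
  prodT-∣⇒∣-pointwise {e} {f} e∣n f∣n N∣ef i =
    subst (n i ∣_) (cong₂ _*_ (gcd-prodT-divisors e∣n i) (gcd-prodT-divisors f∣n i))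
      (∣-*-gcd (prodT e) (prodT f) ∣-refl (∣-trans (∣-prodT n i) N∣ef))

-- The elements a of the class T(x) of ℤ_m all have gcd(a, m) = toDivisor m x.
toDivisor : ℕ → ℕ → ℕ
toDivisor m zero    = m
toDivisor m (suc x) = suc x

toLabel : ℕ → ℕ → ℕ
toLabel m e with e ≟ m
... | yes _ = 0
... | no  _ = e

toDivisor-∣ : ∀ {m x} → ValidLabel m x → toDivisor m x ∣ m
toDivisor-∣ {x = zero}  _                 = ∣-refl
toDivisor-∣ {x = suc x} (inj₂ (x∣m , _)) = x∣m

toLabel-toDivisor : ∀ {m x} → ValidLabel m x → toLabel m (toDivisor m x) ≡ x
toLabel-toDivisor {m} {zero} _ with m ≟ m
... | yes _   = refl
... | no  m≢m = ⊥-elim (m≢m refl)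
toLabel-toDivisor {m} {suc x} (inj₂ (_ , _ , x<m)) with suc x ≟ m
... | yes x≡m = ⊥-elim (<⇒≢ x<m x≡m)
... | no  _   = refl

toDivisor-toLabel : ∀ {m e} → e ≢ 0 → toDivisor m (toLabel m e) ≡ e
toDivisor-toLabel {m} {e} e≢0 with e ≟ m
... | yes e≡m = sym e≡m
toDivisor-toLabel {e = zero}  e≢0 | no _ = ⊥-elim (e≢0 refl)
toDivisor-toLabel {e = suc e} e≢0 | no _ = refl

properDivisor-validLabel : ∀ {m d} .{{_ : NonZero m}} → d ∣ m → d ≢ m → ValidLabel m d
properDivisor-validLabel {m} d∣m d≢m = inj₂ (d∣m , n≢0⇒n>0 d≢0 , ≤∧≢⇒< (∣⇒≤ d∣m) d≢m)
  where
  d≢0 : _ ≢ 0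
  d≢0 refl = ≢-nonZero⁻¹ m (0∣⇒≡0 d∣m)

toLabel-valid : ∀ {m e} .{{_ : NonZero m}} → e ∣ m → ValidLabel m (toLabel m e)
toLabel-valid {m} {e} e∣m with e ≟ m
... | yes _   = inj₁ refl
... | no  e≢m = properDivisor-validLabel e∣m e≢m

∣*⇒∣toDivisor* : ∀ {m} x y → m ∣ x * y → m ∣ toDivisor m x * toDivisor m y
∣*⇒∣toDivisor* zero    y       _    = m∣m*n _
∣*⇒∣toDivisor* (suc x) zero    _    = n∣m*n (suc x)
∣*⇒∣toDivisor* (suc x) (suc y) m∣xy = m∣xy

∣toDivisor*⇒∣* : ∀ {m} x y → m ∣ toDivisor m x * toDivisor m y → m ∣ x * y
∣toDivisor*⇒∣* {m} zero    y       _    = m ∣0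
∣toDivisor*⇒∣* {m} (suc x) zero    _    = subst (m ∣_) (sym (*-zeroʳ (suc x))) (m ∣0)
∣toDivisor*⇒∣*     (suc x) (suc y) m∣xy = m∣xy

module TypeGraphCRT {k} (n : Tuple k) (2≤n : ∀ i → 2 ≤ n i) (n⊥n : PairwiseCoprime n) where

  open CoprimeModuli n n⊥n

  N : ℕ
  N = prodT n

  nᵢ-nonZero : ∀ i → NonZero (n i)
  nᵢ-nonZero i = >-nonZero (<⇒≤ (2≤n i))

  instance
    N-nonZero : NonZero N
    N-nonZero = prodT-nonZero n nᵢ-nonZero

  Labels : Tuple k → Set
  Labels x = ∀ i → ValidLabel (n i) (x i)

  divisors : Tuple k → Tuple k
  divisors x i = toDivisor (n i) (x i)

  encode : Tuple k → ℕ
  encode x = prodT (divisors x)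

  decode : ℕ → Tuple k
  decode d i = toLabel (n i) (gcd d (n i))

  zeros ones : Tuple k
  zeros _ = 0
  ones  _ = 1

  zeros-labels : Labels zeros
  zeros-labels _ = inj₁ refl

  ones-labels : Labels ones
  ones-labels i = inj₂ (1∣ n i , z<s , 2≤n i)

  encode-ones : encode ones ≡ 1
  encode-ones = prodT-1 k

  encode-cong : ∀ {x y} → x ≋ y → encode x ≡ encode y
  encode-cong x≋y = prodT-cong (λ i → cong (toDivisor (n i)) (x≋y i))

  divisors-∣ : ∀ {x} → Labels x → ∀ i → divisors x i ∣ n i
  divisors-∣ lx i = toDivisor-∣ (lx i)

  encode-∣ : ∀ {x} → Labels x → encode x ∣ N
  encode-∣ lx = prodT-mono-∣ (divisors-∣ lx)

  decode-labels : ∀ d → Labels (decode d)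
  decode-labels d i = toLabel-valid {{nᵢ-nonZero i}} (gcd[m,n]∣n d (n i))

  decode-encode : ∀ {x} → Labels x → decode (encode x) ≋ x
  decode-encode {x} lx i = begin
    toLabel (n i) (gcd (encode x) (n i)) ≡⟨ cong (toLabel (n i)) (gcd-comm (encode x) (n i)) ⟩
    toLabel (n i) (gcd (n i) (encode x)) ≡⟨ cong (toLabel (n i)) (gcd-prodT-divisors (divisors-∣ lx) i) ⟩
    toLabel (n i) (divisors x i)         ≡⟨ toLabel-toDivisor (lx i) ⟩
    x i                                  ∎

  encode-decode : ∀ {d} → d ∣ N → encode (decode d) ≡ d
  encode-decode {d} d∣N = begin
    encode (decode d)           ≡⟨ prodT-cong (λ i → toDivisor-toLabel (gcd≢0 i)) ⟩
    prodT (λ i → gcd d (n i))   ≡⟨ gcd-prodT d ⟨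
    gcd d N                     ≡⟨ gcd[d,m]≡d d∣N ⟩
    d                           ∎
    where
    gcd≢0 : ∀ i → gcd d (n i) ≢ 0
    gcd≢0 i = gcd[m,n]≢0 d (n i) (inj₂ (≢-nonZero⁻¹ (n i) {{nᵢ-nonZero i}}))

  encode-injective : ∀ {x y} → Labels x → Labels y → encode x ≡ encode y → x ≋ y
  encode-injective lx ly x≡y i =
    trans (sym (decode-encode lx i)) (trans (cong (λ d → decode d i) x≡y) (decode-encode ly i))

  adjacent⇒∣encode : ∀ {x y} → (∀ i → n i ∣ x i * y i) → N ∣ encode x * encode y
  adjacent⇒∣encode {x} {y} n∣xy = ∣-pointwise⇒prodT-∣ (λ i → ∣*⇒∣toDivisor* (x i) (y i) (n∣xy i))

  ∣encode⇒adjacent : ∀ {x y} → Labels x → Labels y → N ∣ encode x * encode y → ∀ i → n i ∣ x i * y i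
  ∣encode⇒adjacent {x} {y} lx ly N∣xy i =
    ∣toDivisor*⇒∣* (x i) (y i) (prodT-∣⇒∣-pointwise (divisors-∣ lx) (divisors-∣ ly) N∣xy i)

  toVertex : TVertex n → TVertex (single N)
  toVertex (x , lx , x≢0 , x≢1) =
    (λ _ → encode x) , (λ _ → properDivisor-validLabel (encode-∣ lx) e≢N) , e≢0 , e≢1
    where
    -- N is encode zeros definitionally.
    e≢N : encode x ≢ N
    e≢N e≡N = x≢0 (encode-injective lx zeros-labels e≡N)
    e≢0 : ¬ (∀ i → encode x ≡ 0)
    e≢0 e≡0 = ≢-nonZero⁻¹ N (0∣⇒≡0 (subst (_∣ N) (e≡0 Fin.zero) (encode-∣ lx)))
    e≢1 : ¬ (∀ i → encode x ≡ 1)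
    e≢1 e≡1 = x≢1 (encode-injective lx ones-labels (trans (e≡1 Fin.zero) (sym encode-ones)))

  -- A vertex label of Γ^T(ℤ_N) is never 0, since the label tuple has a single entry.
  label-properDivisor : (w : TVertex (single N)) → proj₁ w Fin.zero ∣ N × proj₁ w Fin.zero < N
  label-properDivisor (w , lw , w≢0 , _) with lw Fin.zero
  ... | inj₁ w≡0             = ⊥-elim (w≢0 λ { Fin.zero → w≡0 })
  ... | inj₂ (d∣N , _ , d<N) = d∣N , d<N

  fromVertex : TVertex (single N) → TVertex n
  fromVertex v@(w , _ , _ , w≢1) with label-properDivisor v
  ... | d∣N , d<N = decode d , decode-labels d , x≢0 , x≢1
    where
    d : ℕ
    d = w Fin.zero
    x≢0 : ¬ (decode d ≋ zeros)
    x≢0 x≋0 = <⇒≢ d<N (trans (sym (encode-decode d∣N)) (encode-cong x≋0))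
    x≢1 : ¬ (decode d ≋ ones)
    x≢1 x≋1 = w≢1 λ { Fin.zero → trans (sym (encode-decode d∣N)) (trans (encode-cong x≋1) encode-ones) }

  iso : TypeGraphIso n (single N)
  iso = record
    { to        = toVertex
    ; from      = fromVertex
    ; from-to   = λ { (_ , lx , _) → decode-encode lx }
    ; to-from   = λ { w Fin.zero → encode-decode (proj₁ (label-properDivisor w)) }
    ; to-resp   = λ _ _ x≋y _ → encode-cong x≋y
    ; from-resp = λ _ _ w≋w′ i → cong (λ d → decode d i) (w≋w′ Fin.zero)
    ; adj-to    = λ { (_ , lx , _) (_ , ly , _) (x≢y , n∣xy) →
                      (λ e≋e → x≢y (encode-injective lx ly (e≋e Fin.zero))) , λ _ → adjacent⇒∣encode n∣xy }
    ; adj-from  = λ { (_ , lx , _) (_ , ly , _) (e≢e , N∣ee) →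
                      (λ x≋y → e≢e (λ _ → encode-cong x≋y)) , ∣encode⇒adjacent lx ly (N∣ee Fin.zero) }
    }

theorem1p11 : (k : ℕ) (n : Fin k → ℕ) →
    (∀ i → 2 ≤ n i) →
    (∀ i j → i ≢ j → Coprime (n i) (n j)) →
    TypeGraphIso n (single (prodT n))
theorem1p11 k n 2≤n n⊥n = TypeGraphCRT.iso n 2≤n n⊥n
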